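{- For all $n$, \[\mathrm{ex}_o(n,E) = \binom{n}{3},\] and for each $n$ there is exactly one $E$-free oriented graph on $n$ vertices with $\binom{n}{3}$ edges, up to isomorphism.
   Context: A $2\to1$ directed hypergraph (here simply a "graph") is a pair $H=(V,E)$ with $V$ a finite vertex set and $E$ a set of edges, each edge being a 3-element subset $\{a,b,c\}$ of $V$ with one element marked as the head; the edge with underlying set $\{a,b,c\}$ and head $c$ is written $ab \to c$. $H$ is oriented if every 3-subset of $V$ carries at most one edge. A homomorphism $\phi:F\to G$ is a map $V(F)\to V(G)$ with $ab\to c\in E(F)\Rightarrow \phi(a)\phi(b)\to\phi(c)\in E(G)$. $G$ is $F$-free if there is no injective homomorphism $F\to G$. $\mathrm{ex}_o(n,F)$ is the maximum number of edges of an $F$-free oriented graph on $n$ vertices. The Escher graph $E$ has vertex set $\{a,b,c,d\}$ and edge set $\{ab\to c,\ cd\to b\}$. -}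

module Defs where

open import Data.Nat using (ℕ; zero; suc; _<ᵇ_; _≤_)
open import Data.Nat.Combinatorics using (_C_)
open import Data.Bool using (Bool; true; false; if_then_else_; _∧_)
import Data.Bool.Properties as BoolP
open import Data.Fin using (Fin; toℕ)
open import Data.Fin.Properties using (all?) renaming (_≟_ to _≟ᶠ_)
open import Data.List using (List; map; allFin)
open import Data.Nat.ListAction using (sum)
open import Data.Product using (Σ; _×_; _,_; ∃)
open import Relation.Binary.PropositionalEquality using (_≡_; _≢_; refl)
open import Relation.Nullary using (¬_; ¬?)
open import Relation.Nullary.Decidable using (toWitness; _×-dec_; _→-dec_)
open import Function.Definitions using (Injective)
open import Function.Bundles using (_⤖_; Bijection)

-- A 2→1 directed hypergraph on vertex set Fin n.
-- E a b c ≡ true  means that the edge  ab → c  (tail pair {a,b}, head c) is present.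
-- Since the tail is an unordered pair, E is symmetric in its first two arguments,
-- and every edge has three distinct vertices.
record Graph (n : ℕ) : Set where
  field
    E          : Fin n → Fin n → Fin n → Bool
    E-sym      : ∀ a b c → E a b c ≡ E b a c
    E-distinct : ∀ a b c → E a b c ≡ true → (a ≢ b) × (a ≢ c) × (b ≢ c)
open Graph public

-- Oriented: every 3-subset {a,b,c} carries at most one edge.
-- If ab → c is present, then neither bc → a nor ac → b is present.
Oriented : ∀ {n} → Graph n → Set
Oriented G = ∀ a b c → E G a b c ≡ true → (E G b c a ≡ false) × (E G a c b ≡ false)

-- Number of edges: each edge ab → c is counted once, via the ordering toℕ a < toℕ b.
edgeCount : ∀ {n} → Graph n → ℕ
edgeCount {n} G =
  sum (map (λ a → sum (map (λ b → sum (map (λ c →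
    if (toℕ a <ᵇ toℕ b) ∧ E G a b c then 1 else 0) (allFin n))) (allFin n))) (allFin n))

IsHom : ∀ {m n} → Graph m → Graph n → (Fin m → Fin n) → Set
IsHom F G φ = ∀ a b c → E F a b c ≡ true → E G (φ a) (φ b) (φ c) ≡ true

Free : ∀ {m n} → Graph m → Graph n → Set
Free F G = ¬ (Σ (Fin _ → Fin _) λ φ → Injective _≡_ _≡_ φ × IsHom F G φ)

Iso : ∀ {n} → Graph n → Graph n → Set
Iso {n} G H = Σ (Fin n ⤖ Fin n) λ σ →
  ∀ a b c → E G a b c ≡ E H (Bijection.to σ a) (Bijection.to σ b) (Bijection.to σ c)

-- The Escher graph: vertices a,b,c,d = 0,1,2,3; edges ab → c and cd → b.
escherℕ : ℕ → ℕ → ℕ → Bool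
escherℕ 0 1 2 = true
escherℕ 1 0 2 = true
escherℕ 2 3 1 = true
escherℕ 3 2 1 = true
escherℕ _ _ _ = false

escherE : Fin 4 → Fin 4 → Fin 4 → Bool
escherE a b c = escherℕ (toℕ a) (toℕ b) (toℕ c)

Escher : Graph 4
Escher = record
  { E = escherE
  ; E-sym = toWitness {a? = all? λ a → all? λ b → all? λ c →
                         escherE a b c BoolP.≟ escherE b a c} _
  ; E-distinct = toWitness {a? = all? λ a → all? λ b → all? λ c →
                   (escherE a b c BoolP.≟ true) →-dec
                   (¬? (a ≟ᶠ b) ×-dec ¬? (a ≟ᶠ c) ×-dec ¬? (b ≟ᶠ c))} _
  }

ExO≡ : ℕ → ∀ {k} → Graph k → ℕ → Set
ExO≡ n F m =
  (Σ (Graph n) λ G → Oriented G × Free F G × edgeCount G ≡ m)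
  × (∀ (G : Graph n) → Oriented G → Free F G → edgeCount G ≤ m)

module Submission where

-- A 3-set {a, b, c} can carry the edges ab → c, ac → b and bc → a, and an oriented graph has at
-- most one of them. Regrouping edgeCount by underlying 3-sets therefore bounds it by n C 3, with
-- equality exactly when every 3-set carries an edge. In such a complete, oriented, Escher-free graph
-- put x ↝ y when some edge xz → y exists: Escher-freeness makes ↝ asymmetric, and completeness makes
-- ↝, with ties broken by index, a strict total order ⊏ whose edges ab → c are exactly those with
-- a, b ⊏ c. Two strict total orders on Fin n are isomorphic through their rank functions, hence so
-- are two extremal graphs, and the standard order on Fin n yields one.

open import Defs
open import Data.Bool using (Bool; true; false; if_then_else_; _∧_)
import Data.Bool.Properties as Bool
open import Data.Bool.Properties using (∧-zeroʳ; ∧-identityʳ; T-∧; T-≡; ⇔→≡)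
open import Data.Empty using (⊥)
import Data.Fin
open import Data.Fin using (Fin; zero; suc; toℕ)
open import Data.Fin.Patterns using (0F; 1F; 2F; 3F)
import Data.Fin.Properties as Fin
open import Data.Fin.Properties using (all?; toℕ-injective)
open import Data.List using (allFin; map; tabulate)
open import Data.List.Properties using (map-tabulate)
import Data.Nat.ListAction as List
open import Data.Nat using (ℕ; zero; suc; _+_; _≤_; _<_; _<ᵇ_; z≤n; s≤s)
open import Data.Nat.Combinatorics using (_C_; nCk+nC[k+1]≡[n+1]C[k+1]; nC1≡n)
open import Data.Nat.Properties
open import Algebra.Properties.CommutativeMonoid.Sum +-0-commutativeMonoid
  using (sum; sum-cong-≗; sum-replicate-zero; ∑-comm; ∑-distrib-+)
open import Data.Product using (Σ; ∃; _×_; _,_; proj₁; proj₂)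
open import Data.Product.Properties using (≡-dec)
open import Data.Sum using (_⊎_; inj₁; inj₂)
open import Data.Vec using (Vec; _∷_; []; lookup)
open import Data.Vec.Relation.Unary.All using (_∷_; [])
open import Data.Vec.Relation.Unary.AllPairs using (_∷_; [])
open import Data.Vec.Relation.Unary.Unique.Propositional using (Unique)
open import Data.Vec.Relation.Unary.Unique.Propositional.Properties using (lookup-injective)
open import Function using (_∘_)
open import Function.Bundles using (_⇔_; mk⇔; Equivalence; _⤖_; mk⤖; Bijection)
open import Function.Consequences.Propositional using (strictlySurjective⇒surjective)
open import Function.Definitions using (Injective; StrictlySurjective)
open import Function.Properties.Equivalence using () renaming (trans to ⇔-trans; sym to ⇔-sym)
open import Relation.Binary.Definitions using (DecidableEquality; Trichotomous; tri<; tri≈; tri>)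
open import Relation.Binary.PropositionalEquality
open import Relation.Binary.Structures using (IsStrictTotalOrder)
open import Relation.Nullary using (¬_; ¬?; Dec; yes; no; does; contradiction)
open import Relation.Nullary.Decidable
  using (dec-true; dec-false; does-⇔; toWitness; _×-dec_; _⊎-dec_; _→-dec_)

𝟙 : Bool → ℕ
𝟙 b = if b then 1 else 0

sum-tabulate : ∀ {n} (f : Fin n → ℕ) → List.sum (tabulate f) ≡ sum f
sum-tabulate {zero}  f = refl
sum-tabulate {suc n} f = cong (f zero +_) (sum-tabulate (λ i → f (suc i)))

sum-map-allFin : ∀ {n} (f : Fin n → ℕ) → List.sum (map f (allFin n)) ≡ sum f
sum-map-allFin f = trans (cong List.sum (map-tabulate (λ i → i) f)) (sum-tabulate f)

sum-one : ∀ n → sum {n} (λ _ → 1) ≡ n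
sum-one zero    = refl
sum-one (suc n) = cong suc (sum-one n)

sum-mono-≤ : ∀ {n} {f g : Fin n → ℕ} → (∀ i → f i ≤ g i) → sum f ≤ sum g
sum-mono-≤ {zero}  f≤g = z≤n
sum-mono-≤ {suc n} f≤g = +-mono-≤ (f≤g zero) (sum-mono-≤ (λ i → f≤g (suc i)))

sum-mono-< : ∀ {n} {f g : Fin n → ℕ} → (∀ i → f i ≤ g i) → ∀ k → f k < g k → sum f < sum g
sum-mono-< {suc n} f≤g zero    fk<gk = +-mono-<-≤ fk<gk (sum-mono-≤ (λ i → f≤g (suc i)))
sum-mono-< {suc n} f≤g (suc k) fk<gk = +-mono-≤-< (f≤g zero) (sum-mono-< (λ i → f≤g (suc i)) k fk<gk)

sum-mono-≤-tight : ∀ {n} {f g : Fin n → ℕ} → (∀ i → f i ≤ g i) → sum f ≡ sum g → ∀ i → f i ≡ g i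
sum-mono-≤-tight {f = f} {g} f≤g Σf≡Σg i with f i ≟ g i
... | yes fi≡gi = fi≡gi
... | no  fi≢gi = contradiction Σf≡Σg (<⇒≢ (sum-mono-< f≤g i (≤∧≢⇒< (f≤g i) fi≢gi)))

∑³ : ∀ {n} → (Fin n → Fin n → Fin n → ℕ) → ℕ
∑³ f = sum λ a → sum λ b → sum λ c → f a b c

sum³-map-allFin : ∀ {n} (f : Fin n → Fin n → Fin n → ℕ) →
  List.sum (map (λ a → List.sum (map (λ b → List.sum (map (f a b) (allFin n))) (allFin n))) (allFin n))
  ≡ ∑³ f
sum³-map-allFin {n} f =
  trans (sum-map-allFin (λ a → List.sum (map (λ b → List.sum (map (f a b) (allFin n))) (allFin n))))
    (sum-cong-≗ λ a → trans (sum-map-allFin (λ b → List.sum (map (f a b) (allFin n))))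
                            (sum-cong-≗ λ b → sum-map-allFin (f a b)))

∑³-cong : ∀ {n} {f g : Fin n → Fin n → Fin n → ℕ} → (∀ a b c → f a b c ≡ g a b c) → ∑³ f ≡ ∑³ g
∑³-cong f≗g = sum-cong-≗ λ a → sum-cong-≗ λ b → sum-cong-≗ λ c → f≗g a b c

∑³-distrib-+ : ∀ {n} (f g : Fin n → Fin n → Fin n → ℕ) →
               ∑³ (λ a b c → f a b c + g a b c) ≡ ∑³ f + ∑³ g
∑³-distrib-+ f g = trans
  (sum-cong-≗ λ a → trans (sum-cong-≗ λ b → ∑-distrib-+ (f a b) (g a b))
                          (∑-distrib-+ (λ b → sum (f a b)) (λ b → sum (g a b))))
  (∑-distrib-+ (λ a → sum λ b → sum (f a b)) (λ a → sum λ b → sum (g a b)))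

∑³-swap₂₃ : ∀ {n} (f : Fin n → Fin n → Fin n → ℕ) → ∑³ (λ a b c → f a c b) ≡ ∑³ f
∑³-swap₂₃ f = sum-cong-≗ λ a → ∑-comm (λ b c → f a c b)

∑³-rotate : ∀ {n} (f : Fin n → Fin n → Fin n → ℕ) → ∑³ (λ a b c → f c a b) ≡ ∑³ f
∑³-rotate f = trans (∑³-swap₂₃ (λ a b c → f b a c)) (∑-comm (λ a c → sum λ b → f c a b))

∑³-mono-≤ : ∀ {n} {f g : Fin n → Fin n → Fin n → ℕ} → (∀ a b c → f a b c ≤ g a b c) → ∑³ f ≤ ∑³ g
∑³-mono-≤ f≤g = sum-mono-≤ λ a → sum-mono-≤ λ b → sum-mono-≤ λ c → f≤g a b c

∑³-mono-≤-tight : ∀ {n} {f g : Fin n → Fin n → Fin n → ℕ} → (∀ a b c → f a b c ≤ g a b c) →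
                  ∑³ f ≡ ∑³ g → ∀ a b c → f a b c ≡ g a b c
∑³-mono-≤-tight f≤g eq a b c =
  sum-mono-≤-tight (f≤g a b)
    (sum-mono-≤-tight (λ b → sum-mono-≤ (f≤g a b))
      (sum-mono-≤-tight (λ a → sum-mono-≤ λ b → sum-mono-≤ (f≤g a b)) eq a) b) c

_≺_ : ∀ {n} → Fin n → Fin n → Bool
a ≺ b = toℕ a <ᵇ toℕ b

increasing : ∀ {n} → Fin n → Fin n → Fin n → Bool
increasing a b c = (a ≺ b) ∧ (b ≺ c)

∑²-increasing : ∀ n → sum (λ (a : Fin n) → sum λ b → 𝟙 (a ≺ b)) ≡ n C 2
∑²-increasing zero    = refl
∑²-increasing (suc n) = begin
  sum {n} (λ _ → 1) + sum (λ (a : Fin n) → sum λ b → 𝟙 (a ≺ b)) ≡⟨ cong₂ _+_ (sum-one n) (∑²-increasing n) ⟩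
  n + n C 2                                                       ≡⟨ cong (_+ n C 2) (nC1≡n n) ⟨
  n C 1 + n C 2                                                   ≡⟨ nCk+nC[k+1]≡[n+1]C[k+1] n 1 ⟩
  suc n C 2                                                       ∎
  where open ≡-Reasoning

∑³-increasing : ∀ n → ∑³ (λ (a b c : Fin n) → 𝟙 (increasing a b c)) ≡ n C 3
∑³-increasing zero    = refl
∑³-increasing (suc n) = begin
  ∑³ {suc n} (λ a b c → 𝟙 (increasing a b c))
    ≡⟨ cong₂ _+_ (cong₂ _+_ (sum-replicate-zero (suc n)) (∑²-increasing n)) (sum-cong-≗ drop-zero) ⟩
  n C 2 + ∑³ (λ (a b c : Fin n) → 𝟙 (increasing a b c)) ≡⟨ cong (n C 2 +_) (∑³-increasing n) ⟩
  n C 2 + n C 3                                          ≡⟨ nCk+nC[k+1]≡[n+1]C[k+1] n 2 ⟩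
  suc n C 3                                              ∎
  where
  open ≡-Reasoning
  drop-zero : ∀ a → sum (λ (b : Fin (suc n)) → sum λ c → 𝟙 (increasing (suc a) b c))
                  ≡ sum λ b → sum λ c → 𝟙 (increasing a b c)
  drop-zero a = cong₂ _+_ (sum-replicate-zero (suc n))
    (sum-cong-≗ λ b → cong (_+ sum λ c → 𝟙 (increasing a b c)) (cong 𝟙 (∧-zeroʳ (a ≺ b))))

<⇒<ᵇ≡true : ∀ {m n} → m < n → (m <ᵇ n) ≡ true
<⇒<ᵇ≡true {zero}  {suc n} _         = refl
<⇒<ᵇ≡true {suc m} {suc n} (s≤s m<n) = <⇒<ᵇ≡true m<n

>⇒<ᵇ≡false : ∀ {m n} → n < m → (m <ᵇ n) ≡ false
>⇒<ᵇ≡false {m}     {zero}  _         = refl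
>⇒<ᵇ≡false {suc m} {suc n} (s≤s n<m) = >⇒<ᵇ≡false n<m

-- z lies above, between or below x < y.
<ᵇ-split : ∀ {x y z} → x ≢ y → x ≢ z → y ≢ z →
           𝟙 (x <ᵇ y) ≡ 𝟙 ((x <ᵇ y) ∧ (y <ᵇ z)) + 𝟙 ((x <ᵇ z) ∧ (z <ᵇ y)) + 𝟙 ((z <ᵇ x) ∧ (x <ᵇ y))
<ᵇ-split {x} {y} {z} x≢y x≢z y≢z with <-cmp x y | <-cmp y z | <-cmp x z
... | tri≈ _ x≡y _ | _ | _ = contradiction x≡y x≢y
... | _ | tri≈ _ y≡z _ | _ = contradiction y≡z y≢z
... | _ | _ | tri≈ _ x≡z _ = contradiction x≡z x≢z
... | tri< x<y _ _ | tri< y<z _ _ | _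
  rewrite <⇒<ᵇ≡true x<y | <⇒<ᵇ≡true y<z | <⇒<ᵇ≡true (<-trans x<y y<z)
        | >⇒<ᵇ≡false y<z | >⇒<ᵇ≡false (<-trans x<y y<z) = refl
... | tri< x<y _ _ | tri> _ _ z<y | tri< x<z _ _
  rewrite <⇒<ᵇ≡true x<y | >⇒<ᵇ≡false z<y | <⇒<ᵇ≡true x<z | <⇒<ᵇ≡true z<y | >⇒<ᵇ≡false x<z = refl
... | tri< x<y _ _ | tri> _ _ z<y | tri> _ _ z<x
  rewrite <⇒<ᵇ≡true x<y | >⇒<ᵇ≡false z<y | >⇒<ᵇ≡false z<x | <⇒<ᵇ≡true z<x = refl
... | tri> _ _ y<x | _ | tri< x<z _ _
  rewrite >⇒<ᵇ≡false y<x | <⇒<ᵇ≡true x<z | >⇒<ᵇ≡false (<-trans y<x x<z) | >⇒<ᵇ≡false x<z = refl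
... | tri> _ _ y<x | _ | tri> _ _ z<x
  rewrite >⇒<ᵇ≡false y<x | >⇒<ᵇ≡false z<x | <⇒<ᵇ≡true z<x = refl

𝟙-split-∧ʳ : ∀ {p q r s} e → (e ≡ true → 𝟙 p ≡ 𝟙 q + 𝟙 r + 𝟙 s) →
             𝟙 (p ∧ e) ≡ 𝟙 (q ∧ e) + 𝟙 (r ∧ e) + 𝟙 (s ∧ e)
𝟙-split-∧ʳ {p} {q} {r} {s} false _
  rewrite ∧-zeroʳ p | ∧-zeroʳ q | ∧-zeroʳ r | ∧-zeroʳ s = refl
𝟙-split-∧ʳ {p} {q} {r} {s} true split
  rewrite ∧-identityʳ p | ∧-identityʳ q | ∧-identityʳ r | ∧-identityʳ s = split refl

𝟙-∧-+ : ∀ p x y z → 𝟙 (p ∧ x) + 𝟙 (p ∧ y) + 𝟙 (p ∧ z) ≡ (if p then 𝟙 x + 𝟙 y + 𝟙 z else 0)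
𝟙-∧-+ false x y z = refl
𝟙-∧-+ true  x y z = refl

𝟙-+-≤1 : ∀ x y z → (x ≡ true → y ≡ false) → (x ≡ true → z ≡ false) → (y ≡ true → z ≡ false) →
         𝟙 x + 𝟙 y + 𝟙 z ≤ 1
𝟙-+-≤1 true  y     z     x⇒¬y x⇒¬z _    rewrite x⇒¬y refl | x⇒¬z refl = ≤-refl
𝟙-+-≤1 false true  z     _    _    y⇒¬z rewrite y⇒¬z refl = ≤-refl
𝟙-+-≤1 false false true  _    _    _    = ≤-refl
𝟙-+-≤1 false false false _    _    _    = z≤n

1≤𝟙-+⇔ : ∀ x y z → 1 ≤ 𝟙 x + 𝟙 y + 𝟙 z ⇔ (x ≡ true ⊎ y ≡ true ⊎ z ≡ true)
1≤𝟙-+⇔ true  y     z     = mk⇔ (λ _ → inj₁ refl) (λ _ → s≤s z≤n)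
1≤𝟙-+⇔ false true  z     = mk⇔ (λ _ → inj₂ (inj₁ refl)) (λ _ → s≤s z≤n)
1≤𝟙-+⇔ false false true  = mk⇔ (λ _ → inj₂ (inj₂ refl)) (λ _ → s≤s z≤n)
1≤𝟙-+⇔ false false false = mk⇔ (λ ()) λ { (inj₁ ()) ; (inj₂ (inj₁ ())) ; (inj₂ (inj₂ ())) }

<⇒increasing : ∀ {n} {a b c : Fin n} → toℕ a < toℕ b → toℕ b < toℕ c → increasing a b c ≡ true
<⇒increasing a<b b<c rewrite <⇒<ᵇ≡true a<b | <⇒<ᵇ≡true b<c = refl

increasing⇒< : ∀ {n} {a b c : Fin n} → increasing a b c ≡ true → toℕ a < toℕ b × toℕ b < toℕ c
increasing⇒< inc with ab , bc ← Equivalence.to T-∧ (Equivalence.from T-≡ inc) =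
  <ᵇ⇒< _ _ ab , <ᵇ⇒< _ _ bc

module _ {n : ℕ} (P : Fin n → Fin n → Fin n → Set)
         (swap₁₂ : ∀ {a b c} → P a b c → P b a c) (swap₂₃ : ∀ {a b c} → P a b c → P a c b) where

  module _ (sorted : ∀ {a b c} → toℕ a < toℕ b → toℕ b < toℕ c → P a b c) where

    smaller-first⇒P : ∀ {a b c} → toℕ a < toℕ b → a ≢ c → b ≢ c → P a b c
    smaller-first⇒P {a} {b} {c} a<b a≢c b≢c with Fin.<-cmp b c | Fin.<-cmp a c
    ... | tri< b<c _ _ | _            = sorted a<b b<c
    ... | tri≈ _ b≡c _ | _            = contradiction b≡c b≢c
    ... | tri> _ _ c<b | tri< a<c _ _ = swap₂₃ (sorted a<c c<b)
    ... | tri> _ _ _   | tri≈ _ a≡c _ = contradiction a≡c a≢c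
    ... | tri> _ _ _   | tri> _ _ c<a = swap₂₃ (swap₁₂ (sorted c<a a<b))

    increasing⇒distinct : ∀ a b c → a ≢ b → a ≢ c → b ≢ c → P a b c
    increasing⇒distinct a b c a≢b a≢c b≢c with Fin.<-cmp a b
    ... | tri< a<b _ _ = smaller-first⇒P a<b a≢c b≢c
    ... | tri≈ _ a≡b _ = contradiction a≡b a≢b
    ... | tri> _ _ b<a = swap₁₂ (smaller-first⇒P b<a b≢c a≢c)

-- Counting edges through 3-sets

module _ {n : ℕ} (G : Graph n) where

  edgesOn : Fin n → Fin n → Fin n → ℕ
  edgesOn a b c = 𝟙 (E G a b c) + 𝟙 (E G a c b) + 𝟙 (E G b c a)

  HasEdge : Fin n → Fin n → Fin n → Set
  HasEdge a b c = E G a b c ≡ true ⊎ E G a c b ≡ true ⊎ E G b c a ≡ true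

  Complete : Set
  Complete = ∀ a b c → a ≢ b → a ≢ c → b ≢ c → HasEdge a b c

  HasEdge-swap₁₂ : ∀ {a b c} → HasEdge a b c → HasEdge b a c
  HasEdge-swap₁₂ {a} {b} {c} (inj₁ ab→c)        = inj₁ (trans (E-sym G b a c) ab→c)
  HasEdge-swap₁₂             (inj₂ (inj₁ ac→b)) = inj₂ (inj₂ ac→b)
  HasEdge-swap₁₂             (inj₂ (inj₂ bc→a)) = inj₂ (inj₁ bc→a)

  HasEdge-swap₂₃ : ∀ {a b c} → HasEdge a b c → HasEdge a c b
  HasEdge-swap₂₃             (inj₁ ab→c)        = inj₂ (inj₁ ab→c)
  HasEdge-swap₂₃             (inj₂ (inj₁ ac→b)) = inj₁ ac→b
  HasEdge-swap₂₃ {a} {b} {c} (inj₂ (inj₂ bc→a)) = inj₂ (inj₂ (trans (E-sym G c b a) bc→a))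

  -- An edge ab → c with a < b is recounted at the 3-set {a, b, c} listed increasingly; which of the
  -- three edges of that 3-set it is depends on whether c lies above, between or below a and b.
  edgeCount≡∑³edgesOn : edgeCount G ≡ ∑³ λ a b c → if increasing a b c then edgesOn a b c else 0
  edgeCount≡∑³edgesOn = begin
    edgeCount G
      ≡⟨ sum³-map-allFin (λ a b c → 𝟙 ((a ≺ b) ∧ E G a b c)) ⟩
    ∑³ (λ a b c → 𝟙 ((a ≺ b) ∧ E G a b c))
      ≡⟨ ∑³-cong split ⟩
    ∑³ (λ a b c → F₁ a b c + F₂ a c b + F₃ c a b)
      ≡⟨ trans (∑³-distrib-+ _ F₃′) (cong (_+ ∑³ F₃′) (∑³-distrib-+ F₁ F₂′)) ⟩
    ∑³ F₁ + ∑³ F₂′ + ∑³ F₃′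
      ≡⟨ cong₂ (λ s t → ∑³ F₁ + s + t) (∑³-swap₂₃ F₂) (∑³-rotate F₃) ⟩
    ∑³ F₁ + ∑³ F₂ + ∑³ F₃
      ≡⟨ sym (trans (∑³-distrib-+ _ F₃) (cong (_+ ∑³ F₃) (∑³-distrib-+ F₁ F₂))) ⟩
    ∑³ (λ a b c → F₁ a b c + F₂ a b c + F₃ a b c)
      ≡⟨ ∑³-cong (λ a b c → 𝟙-∧-+ (increasing a b c) (E G a b c) (E G a c b) (E G b c a)) ⟩
    ∑³ (λ a b c → if increasing a b c then edgesOn a b c else 0)
      ∎
    where
    open ≡-Reasoning
    F₁ F₂ F₃ F₂′ F₃′ : Fin n → Fin n → Fin n → ℕ
    F₁ a b c = 𝟙 (increasing a b c ∧ E G a b c)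
    F₂ a b c = 𝟙 (increasing a b c ∧ E G a c b)
    F₃ a b c = 𝟙 (increasing a b c ∧ E G b c a)
    F₂′ a b c = F₂ a c b
    F₃′ a b c = F₃ c a b
    split : ∀ a b c → 𝟙 ((a ≺ b) ∧ E G a b c) ≡ F₁ a b c + F₂ a c b + F₃ c a b
    split a b c = 𝟙-split-∧ʳ {q = increasing a b c} {increasing a c b} {increasing c a b}
                             (E G a b c) λ ab→c →
      let a≢b , a≢c , b≢c = E-distinct G a b c ab→c
      in <ᵇ-split (a≢b ∘ toℕ-injective) (a≢c ∘ toℕ-injective) (b≢c ∘ toℕ-injective)

  module _ (oriented : Oriented G) where

    edgesOn≤1 : ∀ a b c → edgesOn a b c ≤ 1
    edgesOn≤1 a b c = 𝟙-+-≤1 (E G a b c) (E G a c b) (E G b c a)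
      (proj₂ ∘ oriented a b c) (proj₁ ∘ oriented a b c)
      (λ ac→b → trans (E-sym G b c a) (proj₁ (oriented a c b ac→b)))

    increasing-edgesOn≤ : ∀ a b c → (if increasing a b c then edgesOn a b c else 0) ≤ 𝟙 (increasing a b c)
    increasing-edgesOn≤ a b c with increasing a b c
    ... | true  = edgesOn≤1 a b c
    ... | false = z≤n

    edgesOn≡1⇔HasEdge : ∀ a b c → edgesOn a b c ≡ 1 ⇔ HasEdge a b c
    edgesOn≡1⇔HasEdge a b c = mk⇔
      (λ eq → Equivalence.to (1≤𝟙-+⇔ _ _ _) (≤-reflexive (sym eq)))
      (λ has → ≤-antisym (edgesOn≤1 a b c) (Equivalence.from (1≤𝟙-+⇔ _ _ _) has))

    edgeCount≤ : edgeCount G ≤ n C 3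
    edgeCount≤ = begin
      edgeCount G                                                  ≡⟨ edgeCount≡∑³edgesOn ⟩
      ∑³ (λ a b c → if increasing a b c then edgesOn a b c else 0) ≤⟨ ∑³-mono-≤ increasing-edgesOn≤ ⟩
      ∑³ (λ (a b c : Fin n) → 𝟙 (increasing a b c))                ≡⟨ ∑³-increasing n ⟩
      n C 3                                                        ∎
      where open ≤-Reasoning

    edgeCount≡⇒Complete : edgeCount G ≡ n C 3 → Complete
    edgeCount≡⇒Complete eq = increasing⇒distinct HasEdge HasEdge-swap₁₂ HasEdge-swap₂₃ sorted
      where
      tight : ∀ a b c → (if increasing a b c then edgesOn a b c else 0) ≡ 𝟙 (increasing a b c)
      tight = ∑³-mono-≤-tight increasing-edgesOn≤
        (trans (sym edgeCount≡∑³edgesOn) (trans eq (sym (∑³-increasing n))))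
      sorted : ∀ {a b c} → toℕ a < toℕ b → toℕ b < toℕ c → HasEdge a b c
      sorted {a} {b} {c} a<b b<c with tight a b c
      ... | edges≡1 rewrite <⇒increasing {a = a} {b} {c} a<b b<c =
        Equivalence.to (edgesOn≡1⇔HasEdge a b c) edges≡1

    Complete⇒edgeCount≡ : Complete → edgeCount G ≡ n C 3
    Complete⇒edgeCount≡ complete =
      trans edgeCount≡∑³edgesOn (trans (∑³-cong edges≡increasing) (∑³-increasing n))
      where
      edges≡increasing : ∀ a b c → (if increasing a b c then edgesOn a b c else 0) ≡ 𝟙 (increasing a b c)
      edges≡increasing a b c with increasing a b c in inc
      ... | false = refl
      ... | true  = let a<b , b<c = increasing⇒< inc in
        Equivalence.from (edgesOn≡1⇔HasEdge a b c)
          (complete a b c (Fin.<⇒≢ a<b) (Fin.<⇒≢ (<-trans a<b b<c)) (Fin.<⇒≢ b<c))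

-- Strict total orders on Fin n

injective⇒strictlySurjective : ∀ {n} {f : Fin n → Fin n} → Injective _≡_ _≡_ f → StrictlySurjective _≡_ f
injective⇒strictlySurjective {suc m} {f} f-inj y with Fin.any? (λ x → f x Fin.≟ y)
... | yes hit = hit
... | no  miss = contradiction (Fin.injective⇒≤ punchOut-inj) 1+n≰n
  where
  fx≢y : ∀ x → y ≢ f x
  fx≢y x y≡fx = miss (x , sym y≡fx)
  punchOut-inj : Injective _≡_ _≡_ (λ x → Data.Fin.punchOut (fx≢y x))
  punchOut-inj eq = f-inj (Fin.punchOut-injective (fx≢y _) (fx≢y _) eq)

injective⇒bijection : ∀ {n} {f : Fin n → Fin n} → Injective _≡_ _≡_ f → Fin n ⤖ Fin n
injective⇒bijection f-inj = mk⤖ (f-inj , strictlySurjective⇒surjective (injective⇒strictlySurjective f-inj))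

module Rank {n : ℕ} {_⊏_ : Fin n → Fin n → Set} (sto : IsStrictTotalOrder _≡_ _⊏_) where
  open IsStrictTotalOrder sto using (irrefl; compare) renaming (_<?_ to _⊏?_; trans to ⊏-trans)

  rankℕ : Fin n → ℕ
  rankℕ a = sum λ w → 𝟙 (does (w ⊏? a))

  rankℕ-mono : ∀ {a b} → a ⊏ b → rankℕ a < rankℕ b
  rankℕ-mono {a} {b} a⊏b = sum-mono-< below-a≤below-b a (begin-strict
    𝟙 (does (a ⊏? a)) ≡⟨ cong 𝟙 (dec-false (a ⊏? a) (irrefl refl)) ⟩
    0                 <⟨ s≤s z≤n ⟩
    1                 ≡⟨ cong 𝟙 (dec-true (a ⊏? b) a⊏b) ⟨
    𝟙 (does (a ⊏? b)) ∎)
    where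
    open ≤-Reasoning
    below-a≤below-b : ∀ w → 𝟙 (does (w ⊏? a)) ≤ 𝟙 (does (w ⊏? b))
    below-a≤below-b w with w ⊏? a
    ... | yes w⊏a = ≤-reflexive (cong 𝟙 (sym (dec-true (w ⊏? b) (⊏-trans w⊏a a⊏b))))
    ... | no  _   = z≤n

  rankℕ<n : ∀ a → rankℕ a < n
  rankℕ<n a = begin-strict
    rankℕ a           <⟨ sum-mono-< ≤1 a (≤-reflexive (cong (suc ∘ 𝟙) (dec-false (a ⊏? a) (irrefl refl)))) ⟩
    sum {n} (λ _ → 1) ≡⟨ sum-one n ⟩
    n                 ∎
    where
    open ≤-Reasoning
    ≤1 : ∀ w → 𝟙 (does (w ⊏? a)) ≤ 1
    ≤1 w with does (w ⊏? a)
    ... | true  = ≤-refl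
    ... | false = z≤n

  rank : Fin n → Fin n
  rank a = Data.Fin.fromℕ< (rankℕ<n a)

  rank-mono : ∀ {a b} → a ⊏ b → toℕ (rank a) < toℕ (rank b)
  rank-mono {a} {b} a⊏b
    rewrite Fin.toℕ-fromℕ< (rankℕ<n a) | Fin.toℕ-fromℕ< (rankℕ<n b) = rankℕ-mono a⊏b

  rank-⇔ : ∀ {a b} → a ⊏ b ⇔ toℕ (rank a) < toℕ (rank b)
  rank-⇔ {a} {b} = mk⇔ rank-mono reflect
    where
    reflect : toℕ (rank a) < toℕ (rank b) → a ⊏ b
    reflect ra<rb with compare a b
    ... | tri< a⊏b _ _ = a⊏b
    ... | tri≈ _ refl _ = contradiction ra<rb (<-irrefl refl)
    ... | tri> _ _ b⊏a = contradiction ra<rb (<-asym (rank-mono b⊏a))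

  rank-injective : Injective _≡_ _≡_ rank
  rank-injective {a} {b} ra≡rb with compare a b
  ... | tri< a⊏b _ _ = contradiction (cong toℕ ra≡rb) (<⇒≢ (rank-mono a⊏b))
  ... | tri≈ _ a≡b _ = a≡b
  ... | tri> _ _ b⊏a = contradiction (cong toℕ (sym ra≡rb)) (<⇒≢ (rank-mono b⊏a))

strictTotalOrders-isomorphic : ∀ {n} {_⊏₁_ _⊏₂_ : Fin n → Fin n → Set} →
  IsStrictTotalOrder _≡_ _⊏₁_ → IsStrictTotalOrder _≡_ _⊏₂_ →
  Σ (Fin n ⤖ Fin n) λ σ → ∀ {a b} → a ⊏₁ b ⇔ Bijection.to σ a ⊏₂ Bijection.to σ b
strictTotalOrders-isomorphic {n} sto₁ sto₂ = injective⇒bijection σ-injective , λ {a} {b} →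
  ⇔-trans (R₁.rank-⇔)
    (⇔-trans (mk⇔ (subst₂ _<_ (cong toℕ (sym (rank₂∘σ a))) (cong toℕ (sym (rank₂∘σ b))))
                  (subst₂ _<_ (cong toℕ (rank₂∘σ a)) (cong toℕ (rank₂∘σ b))))
             (⇔-sym R₂.rank-⇔))
  where
  module R₁ = Rank sto₁
  module R₂ = Rank sto₂
  σ : Fin n → Fin n
  σ a = proj₁ (injective⇒strictlySurjective R₂.rank-injective (R₁.rank a))
  rank₂∘σ : ∀ a → R₂.rank (σ a) ≡ R₁.rank a
  rank₂∘σ a = proj₂ (injective⇒strictlySurjective R₂.rank-injective (R₁.rank a))
  σ-injective : Injective _≡_ _≡_ σ
  σ-injective {a} {b} σa≡σb = R₁.rank-injective (begin
    R₁.rank a     ≡⟨ rank₂∘σ a ⟨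
    R₂.rank (σ a) ≡⟨ cong R₂.rank σa≡σb ⟩
    R₂.rank (σ b) ≡⟨ rank₂∘σ b ⟩
    R₁.rank b     ∎)
    where open ≡-Reasoning

GeneratedBy : ∀ {n} → Graph n → (Fin n → Fin n → Set) → Set
GeneratedBy G _⊏_ = ∀ a b c → E G a b c ≡ true ⇔ (a ≢ b × a ⊏ c × b ⊏ c)

GeneratedBy-iso : ∀ {n} {G H : Graph n} {_⊏₁_ _⊏₂_ : Fin n → Fin n → Set} →
  GeneratedBy G _⊏₁_ → GeneratedBy H _⊏₂_ →
  (σ : Fin n ⤖ Fin n) → (∀ {a b} → a ⊏₁ b ⇔ Bijection.to σ a ⊏₂ Bijection.to σ b) → Iso G H
GeneratedBy-iso {n} {_⊏₁_ = _⊏₁_} {_⊏₂_} G-gen H-gen σ σ-mono = σ , λ a b c →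
  ⇔→≡ (⇔-trans (G-gen a b c) (⇔-trans (mk⇔ to from) (⇔-sym (H-gen (σ⟨ a ⟩) (σ⟨ b ⟩) (σ⟨ c ⟩)))))
  where
  σ⟨_⟩ : Fin n → Fin n
  σ⟨_⟩ = Bijection.to σ
  to : ∀ {a b c} → a ≢ b × a ⊏₁ c × b ⊏₁ c → σ⟨ a ⟩ ≢ σ⟨ b ⟩ × σ⟨ a ⟩ ⊏₂ σ⟨ c ⟩ × σ⟨ b ⟩ ⊏₂ σ⟨ c ⟩
  to (a≢b , a⊏c , b⊏c) =
    a≢b ∘ Bijection.injective σ , Equivalence.to σ-mono a⊏c , Equivalence.to σ-mono b⊏c
  from : ∀ {a b c} → σ⟨ a ⟩ ≢ σ⟨ b ⟩ × σ⟨ a ⟩ ⊏₂ σ⟨ c ⟩ × σ⟨ b ⟩ ⊏₂ σ⟨ c ⟩ → a ≢ b × a ⊏₁ c × b ⊏₁ c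
  from (σa≢σb , σa⊏σc , σb⊏σc) =
    σa≢σb ∘ cong σ⟨_⟩ , Equivalence.from σ-mono σa⊏σc , Equivalence.from σ-mono σb⊏σc

-- Escher-free complete graphs

escher-edges : ∀ x y z → escherE x y z ≡ true →
  (x , y , z) ≡ (0F , 1F , 2F) ⊎ (x , y , z) ≡ (1F , 0F , 2F) ⊎
  (x , y , z) ≡ (2F , 3F , 1F) ⊎ (x , y , z) ≡ (3F , 2F , 1F)
escher-edges = toWitness {a? = all? λ x → all? λ y → all? λ z →
  (escherE x y z Bool.≟ true) →-dec
    (t x y z ≟³ (0F , 1F , 2F) ⊎-dec t x y z ≟³ (1F , 0F , 2F) ⊎-dec
     t x y z ≟³ (2F , 3F , 1F) ⊎-dec t x y z ≟³ (3F , 2F , 1F))} _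
  where
  t : Fin 4 → Fin 4 → Fin 4 → Fin 4 × Fin 4 × Fin 4
  t x y z = x , y , z
  _≟³_ : DecidableEquality (Fin 4 × Fin 4 × Fin 4)
  _≟³_ = ≡-dec Fin._≟_ (≡-dec Fin._≟_ Fin._≟_)

module EscherFree {n : ℕ} (G : Graph n) (oriented : Oriented G) (free : Free Escher G) where

  no-escher : ∀ {a b c d} → a ≢ d → E G a b c ≡ true → E G c d b ≡ true → ⊥
  no-escher {a} {b} {c} {d} a≢d ab→c cd→b = free (lookup vertices , lookup-injective distinct _ _ , hom)
    where
    vertices : Vec (Fin n) 4
    vertices = a ∷ b ∷ c ∷ d ∷ []
    distinct : Unique vertices
    distinct with a≢b , a≢c , b≢c ← E-distinct G a b c ab→c
                | c≢d , c≢b , d≢b ← E-distinct G c d b cd→b =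
      (a≢b ∷ a≢c ∷ a≢d ∷ []) ∷ (b≢c ∷ (d≢b ∘ sym) ∷ []) ∷ (c≢d ∷ []) ∷ [] ∷ []
    hom : IsHom Escher G (lookup vertices)
    hom x y z e with escher-edges x y z e
    ... | inj₁ refl               = ab→c
    ... | inj₂ (inj₁ refl)        = trans (E-sym G b a c) ab→c
    ... | inj₂ (inj₂ (inj₁ refl)) = cd→b
    ... | inj₂ (inj₂ (inj₂ refl)) = trans (E-sym G d c b) cd→b

  _↝_ : Fin n → Fin n → Set
  x ↝ y = ∃ λ z → E G x z y ≡ true

  ↝-asym : ∀ {x y} → x ↝ y → ¬ y ↝ x
  ↝-asym {x} {y} (z , xz→y) (w , yw→x) with z Fin.≟ w
  ... | yes refl = contradiction (trans (sym zy→x) (proj₁ (oriented x z y xz→y))) λ ()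
    where
    zy→x : E G z y x ≡ true
    zy→x = trans (E-sym G z y x) yw→x
  ... | no  z≢w  = no-escher z≢w (trans (E-sym G z x y) xz→y) yw→x

  -- ↝ does not relate the two tails of an edge, so such ties are broken by index.
  _⊏_ : Fin n → Fin n → Set
  x ⊏ y = x ↝ y ⊎ (¬ y ↝ x × toℕ x < toℕ y)

  ⊏⇒¬↝ : ∀ {x y} → x ⊏ y → ¬ y ↝ x
  ⊏⇒¬↝ (inj₁ x↝y)        = ↝-asym x↝y
  ⊏⇒¬↝ (inj₂ (¬y↝x , _)) = ¬y↝x

  ⊏-irrefl : ∀ {x y} → x ≡ y → ¬ x ⊏ y
  ⊏-irrefl refl (inj₁ (z , xz→x)) = proj₁ (proj₂ (E-distinct G _ z _ xz→x)) refl
  ⊏-irrefl refl (inj₂ (_ , x<x))  = <-irrefl refl x<x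

  ⊏-asym : ∀ {x y} → x ⊏ y → ¬ y ⊏ x
  ⊏-asym (inj₁ x↝y)         y⊏x              = ⊏⇒¬↝ y⊏x x↝y
  ⊏-asym (inj₂ (¬y↝x , _))  (inj₁ y↝x)       = ¬y↝x y↝x
  ⊏-asym (inj₂ (_ , x<y))   (inj₂ (_ , y<x)) = <-asym x<y y<x

  ⊏-connected : ∀ {x y} → x ≢ y → x ⊏ y ⊎ y ⊏ x
  ⊏-connected {x} {y} x≢y
    with Fin.any? (λ z → E G x z y Bool.≟ true) | Fin.any? (λ z → E G y z x Bool.≟ true)
  ... | yes x↝y  | _        = inj₁ (inj₁ x↝y)
  ... | no  _    | yes y↝x  = inj₂ (inj₁ y↝x)
  ... | no  ¬x↝y | no  ¬y↝x with Fin.<-cmp x y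
  ...   | tri< x<y _ _ = inj₁ (inj₂ (¬y↝x , x<y))
  ...   | tri≈ _ x≡y _ = contradiction x≡y x≢y
  ...   | tri> _ _ y<x = inj₂ (inj₂ (¬x↝y , y<x))

  ⊏-compare : Trichotomous _≡_ _⊏_
  ⊏-compare x y with x Fin.≟ y
  ... | yes x≡y = tri≈ (⊏-irrefl x≡y) x≡y (⊏-irrefl (sym x≡y))
  ... | no  x≢y with ⊏-connected x≢y
  ...   | inj₁ x⊏y = tri< x⊏y x≢y (⊏-asym x⊏y)
  ...   | inj₂ y⊏x = tri> (⊏-asym y⊏x) x≢y y⊏x

  module _ (complete : Complete G) where

    ⊏-trans : ∀ {x y z} → x ⊏ y → y ⊏ z → x ⊏ z
    ⊏-trans {x} {y} {z} x⊏y y⊏z with x Fin.≟ z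
    ... | yes refl = contradiction y⊏z (⊏-asym x⊏y)
    ... | no  x≢z with complete x y z (λ x≡y → ⊏-irrefl x≡y x⊏y) x≢z (λ y≡z → ⊏-irrefl y≡z y⊏z)
    ...   | inj₁ xy→z        = inj₁ (y , xy→z)
    ...   | inj₂ (inj₁ xz→y) = contradiction (x , trans (E-sym G z x y) xz→y) (⊏⇒¬↝ y⊏z)
    ...   | inj₂ (inj₂ yz→x) = contradiction (z , yz→x) (⊏⇒¬↝ x⊏y)

    ⊏-isStrictTotalOrder : IsStrictTotalOrder _≡_ _⊏_
    ⊏-isStrictTotalOrder = record
      { isStrictPartialOrder = record
        { isEquivalence = isEquivalence
        ; irrefl        = ⊏-irrefl
        ; trans         = ⊏-trans
        ; <-resp-≈      = resp₂ _⊏_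
        }
      ; compare = ⊏-compare
      }

    generatedBy-⊏ : GeneratedBy G _⊏_
    generatedBy-⊏ a b c = mk⇔ to from
      where
      to : E G a b c ≡ true → a ≢ b × a ⊏ c × b ⊏ c
      to ab→c = proj₁ (E-distinct G a b c ab→c) , inj₁ (b , ab→c) , inj₁ (a , trans (E-sym G b a c) ab→c)
      from : a ≢ b × a ⊏ c × b ⊏ c → E G a b c ≡ true
      from (a≢b , a⊏c , b⊏c) with complete a b c a≢b (λ a≡c → ⊏-irrefl a≡c a⊏c) (λ b≡c → ⊏-irrefl b≡c b⊏c)
      ... | inj₁ ab→c        = ab→c
      ... | inj₂ (inj₁ ac→b) = contradiction (a , trans (E-sym G c a b) ac→b) (⊏⇒¬↝ b⊏c)
      ... | inj₂ (inj₂ bc→a) = contradiction (b , trans (E-sym G c b a) bc→a) (⊏⇒¬↝ a⊏c)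

-- The extremal graph

does≡true⇒ : ∀ {P : Set} (P? : Dec P) → does P? ≡ true → P
does≡true⇒ (yes p) _  = p
does≡true⇒ (no _)  ()

top? : ∀ {n} (a b c : Fin n) → Dec (a ≢ b × toℕ a < toℕ c × toℕ b < toℕ c)
top? a b c = ¬? (a Fin.≟ b) ×-dec (a Fin.<? c) ×-dec (b Fin.<? c)

orderGraph : ∀ n → Graph n
orderGraph n = record
  { E          = λ a b c → does (top? a b c)
  ; E-sym      = λ a b c → does-⇔ (mk⇔ swap swap) (top? a b c) (top? b a c)
  ; E-distinct = λ a b c ab→c → let a≢b , a<c , b<c = does≡true⇒ (top? a b c) ab→c
                                in a≢b , Fin.<⇒≢ a<c , Fin.<⇒≢ b<c
  }
  where
  swap : ∀ {a b c : Fin n} → a ≢ b × toℕ a < toℕ c × toℕ b < toℕ c → b ≢ a × toℕ b < toℕ c × toℕ a < toℕ c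
  swap (a≢b , a<c , b<c) = a≢b ∘ sym , b<c , a<c

generatedBy-< : ∀ n → GeneratedBy (orderGraph n) (λ a b → toℕ a < toℕ b)
generatedBy-< n a b c = mk⇔ (does≡true⇒ (top? a b c)) (dec-true (top? a b c))

module _ (n : ℕ) where
  open Equivalence

  orderGraph-oriented : Oriented (orderGraph n)
  orderGraph-oriented a b c ab→c = let _ , a<c , b<c = to (generatedBy-< n a b c) ab→c in
    dec-false (top? b c a) (λ (_ , _ , c<a) → <-asym a<c c<a) ,
    dec-false (top? a c b) (λ (_ , _ , c<b) → <-asym b<c c<b)

  orderGraph-escherFree : Free Escher (orderGraph n)
  orderGraph-escherFree (φ , _ , hom) =
    <-asym (proj₂ (proj₂ (to (generatedBy-< n (φ 0F) (φ 1F) (φ 2F)) (hom 0F 1F 2F refl))))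
           (proj₁ (proj₂ (to (generatedBy-< n (φ 2F) (φ 3F) (φ 1F)) (hom 2F 3F 1F refl))))

  orderGraph-complete : Complete (orderGraph n)
  orderGraph-complete = increasing⇒distinct (HasEdge G)
    (λ {a} {b} {c} → HasEdge-swap₁₂ G {a} {b} {c}) (λ {a} {b} {c} → HasEdge-swap₂₃ G {a} {b} {c})
    λ {a} {b} {c} a<b b<c → inj₁ (from (generatedBy-< n a b c) (Fin.<⇒≢ a<b , <-trans a<b b<c , b<c))
    where G = orderGraph n

theorem5 : ∀ (n : ℕ) →
    ExO≡ n Escher (n C 3)
    × (∀ (G H : Graph n) →
    Oriented G → Free Escher G → edgeCount G ≡ n C 3 →
    Oriented H → Free Escher H → edgeCount H ≡ n C 3 →
    Iso G H)
theorem5 n = (extremal , λ G oriented _ → edgeCount≤ G oriented) , unique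
  where
  extremal : Σ (Graph n) λ G → Oriented G × Free Escher G × edgeCount G ≡ n C 3
  extremal = orderGraph n , orderGraph-oriented n , orderGraph-escherFree n ,
             Complete⇒edgeCount≡ (orderGraph n) (orderGraph-oriented n) (orderGraph-complete n)
  unique : ∀ (G H : Graph n) →
    Oriented G → Free Escher G → edgeCount G ≡ n C 3 →
    Oriented H → Free Escher H → edgeCount H ≡ n C 3 → Iso G H
  unique G H oG fG eG oH fH eH =
    let σ , σ-mono = strictTotalOrders-isomorphic (G.⊏-isStrictTotalOrder cG) (H.⊏-isStrictTotalOrder cH)
    in GeneratedBy-iso {G = G} {H} (G.generatedBy-⊏ cG) (H.generatedBy-⊏ cH) σ σ-mono
    where
    module G = EscherFree G oG fG
    module H = EscherFree H oH fH
    cG : Complete G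
    cG = edgeCount≡⇒Complete G oG eG
    cH : Complete H
    cH = edgeCount≡⇒Complete H oH eH
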